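{- Let $\sigma\in\mathfrak{S}_n$ be a simsun permutation that avoids the pattern $213$. Then $\sigma^{ -1}$ is simsun if and only if either $\sigma$ contains no $4132$-pattern, or every occurrence of a $4132$-pattern in $\sigma$ is contained in an occurrence of a $51342$-pattern in $\sigma$.
   Context: For $\sigma\in\mathfrak{S}_n$, a double descent is an index $i$ with $\sigma_i>\sigma_{i+1}>\sigma_{i+2}$. The permutation $\sigma$ is simsun if for every $k$, the subword of $\sigma$ consisting of the letters in $\{1,\dots,k\}$ (in the order they appear in $\sigma$) has no double descent. For $\omega\in\mathfrak{S}_t$, an occurrence of an $\omega$-pattern in $\sigma$ is a sequence of indices $i_1<\cdots<i_t$ with $\sigma_{i_j}<\sigma_{i_k}$ iff $\omega_j<\omega_k$; $\sigma$ avoids $\omega$ if there is no occurrence. An occurrence of a $4132$-pattern at indices $i_1<i_2<i_3<i_4$ is contained in an occurrence of a $51342$-pattern if there is an occurrence of $51342$ at indices $j_1<\dots<j_5$ with $\{i_1,i_2,i_3,i_4\}\subseteq\{j_1,\dots,j_5\}$. -}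

module Defs where

open import Data.Nat using (ℕ; _≤_; _<_)
open import Data.Fin using (Fin; toℕ)
open import Data.Fin.Permutation using (Permutation′; _⟨$⟩ʳ_)
open import Data.List using (List; _∷_; map; filter; allFin)
open import Data.Vec using (Vec; lookup; []; _∷_)
open import Data.Product using (Σ; _×_; ∃)
open import Relation.Nullary using (¬_)
open import Relation.Unary using (Decidable)
open import Relation.Binary.PropositionalEquality using (_≡_)
open import Function.Bundles using (_⇔_)
import Data.Nat.Properties as ℕP

-- Position i (0-based) holds the letter
-- σ ⟨$⟩ʳ i; the letter x : Fin n stands for the value toℕ x + 1.
-- Letters are compared through Data.Fin._<_ (i.e. via toℕ).

private
  variable
    n t : ℕ

word : Permutation′ n → List (Fin n)
word σ = map (σ ⟨$⟩ʳ_) (allFin _)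

data HasDoubleDescent {n : ℕ} : List (Fin n) → Set where
  here  : ∀ {a b c xs} → toℕ b < toℕ a → toℕ c < toℕ b →
          HasDoubleDescent (a ∷ b ∷ c ∷ xs)
  there : ∀ {x xs} → HasDoubleDescent xs → HasDoubleDescent (x ∷ xs)

-- Letters in {1,…,k}: the Fin-letter x stands for toℕ x + 1, so x ∈ {1..k}
-- iff toℕ x < k.
inFirst : (k : ℕ) → Decidable (λ (x : Fin n) → toℕ x < k)
inFirst k x = toℕ x ℕP.<? k

restrictWord : ℕ → Permutation′ n → List (Fin n)
restrictWord k σ = filter (inFirst k) (word σ)

-- σ is simsun: for every k (1 ≤ k ≤ n; k = 0 gives the empty word),
-- the subword on {1,…,k} has no double descent.
Simsun : Permutation′ n → Set
Simsun {n} σ = ∀ (k : ℕ) → k ≤ n → ¬ HasDoubleDescent (restrictWord k σ)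

-- An occurrence of the pattern ω (given by its one-line word of values,
-- a permutation of 1..t) in σ: strictly increasing positions i₁<…<iₜ with
-- σ(i_j) < σ(i_k) iff ω_j < ω_k.
record Occurrence {t n : ℕ} (ω : Vec ℕ t) (σ : Permutation′ n) : Set where
  field
    pos        : Fin t → Fin n
    increasing : ∀ (j k : Fin t) → toℕ j < toℕ k → toℕ (pos j) < toℕ (pos k)
    orderIso   : ∀ (j k : Fin t) →
                 (toℕ (σ ⟨$⟩ʳ pos j) < toℕ (σ ⟨$⟩ʳ pos k)) ⇔ (lookup ω j < lookup ω k)

open Occurrence public

Contains : Vec ℕ t → Permutation′ n → Set
Contains ω σ = Occurrence ω σ

Avoids : Vec ℕ t → Permutation′ n → Set
Avoids ω σ = ¬ Occurrence ω σ

p213 : Vec ℕ 3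
p213 = 2 ∷ 1 ∷ 3 ∷ []

p4132 : Vec ℕ 4
p4132 = 4 ∷ 1 ∷ 3 ∷ 2 ∷ []

p51342 : Vec ℕ 5
p51342 = 5 ∷ 1 ∷ 3 ∷ 4 ∷ 2 ∷ []

ContainedIn51342 : {σ : Permutation′ n} → Occurrence p4132 σ → Set
ContainedIn51342 {σ = σ} o =
  Σ (Occurrence p51342 σ) λ O →
    ∀ (j : Fin 4) → ∃ λ (k : Fin 5) → pos o j ≡ pos O k

-- A filler of a 4132-occurrence o is a letter whose insertion into o gives a
-- 51342.  Since deleting its 3 or its 4 are the only ways to see 4132 inside
-- 51342, o lies in a 51342 iff it has a filler.  Backward: a double descent
-- x < y < z of σ⁻¹ on initial letters, together with the first suitable
-- position after the one of z, yields a double descent of σ or a 4132 without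
-- filler.  Forward: for a 4132 at a < b < c < d, an extremal letter placed
-- before d is a filler, since otherwise σ⁻¹ has a double descent or σ a 213.
module Submission where

open import Defs
open import Data.Nat using (ℕ; zero; suc; _≤_; _<_; s≤s)
import Data.Nat.Properties as ℕP
open import Data.Fin using (Fin; toℕ; fromℕ<; #_; zero; suc)
open import Data.Fin.Properties using (all?)
import Data.Fin.Properties as FinP
open import Data.Fin.Permutation using (Permutation′; flip; _⟨$⟩ʳ_; _⟨$⟩ˡ_; inverseˡ; inverseʳ)
open import Data.List using (List; []; _∷_; map; filter; allFin)
open import Data.List.Properties using (filter-accept; filter-reject; ∷-injective)
import Data.List.Relation.Unary.All as All
open import Data.List.Relation.Unary.AllPairs using (AllPairs; []; _∷_)
open import Data.List.Relation.Unary.AllPairs.Properties using (tabulate⁺-<)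
open import Data.List.Relation.Unary.Any using (here; there)
open import Data.List.Membership.Propositional using (_∈_)
open import Data.List.Membership.Propositional.Properties using (∈-allFin)
open import Data.Vec using (Vec; []; _∷_; lookup; tabulate)
import Data.Vec as Vec
open import Data.Vec.Properties using (lookup-map; lookup∘tabulate; ≡-dec)
open import Data.Vec.Relation.Unary.Linked using (Linked; [-]; _∷_)
open import Data.Vec.Relation.Unary.Linked.Properties using (lookup⁺)
open import Data.Product using (∃; ∃-syntax; _×_; _,_; proj₁; proj₂)
open import Data.Sum using (_⊎_; inj₁; inj₂)
open import Data.Empty using (⊥; ⊥-elim)
open import Relation.Nullary using (¬_; ¬?; yes; no; Dec; contradiction)
open import Relation.Nullary.Decidable using (True; toWitness; map′; _×-dec_; _→-dec_; _⊎-dec_; from-yes)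
open import Relation.Unary using (Decidable)
open import Relation.Binary using (tri<; tri≈; tri>)
open import Relation.Binary.PropositionalEquality using (_≡_; _≢_; refl; sym; trans; cong; subst; subst₂)
open import Function.Bundles using (_⇔_; mk⇔; Equivalence)

Sorted : ∀ {m} → List (Fin m) → Set
Sorted = AllPairs (λ p q → toℕ p < toℕ q)

allFin-sorted : ∀ m → Sorted (allFin m)
allFin-sorted m = tabulate⁺-< (λ i<j → i<j)

InGaps : ℕ → ℕ → ℕ → ℕ → Set
InGaps i j l p = (i < p × p < j) ⊎ (j < p × p < l)

module Restriction {m n : ℕ} (f : Fin m → Fin n) (K : ℕ) where

  Kept : Fin m → Set
  Kept p = toℕ (f p) < K

  restrict : List (Fin m) → List (Fin n)
  restrict L = filter (inFirst K) (map f L)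

  keep : ∀ {x} L → Kept x → restrict (x ∷ L) ≡ f x ∷ restrict L
  keep L = filter-accept (inFirst K)

  skip : ∀ {x} L → ¬ Kept x → restrict (x ∷ L) ≡ restrict L
  skip L = filter-reject (inFirst K)

  record FirstKept (L : List (Fin m)) (j : Fin m) (R : List (Fin m)) : Set where
    field
      member : j ∈ L
      kept   : Kept j
      before : ∀ {p} → p ∈ L → toℕ p < toℕ j → ¬ Kept p
      after  : ∀ {p} → p ∈ L → toℕ j < toℕ p → p ∈ R
      within : ∀ {p} → p ∈ R → p ∈ L × toℕ j < toℕ p
      sorted : Sorted R
      unfold : restrict L ≡ f j ∷ restrict R

  private
    beyondHead : ∀ {x p : Fin m} {L} → p ∈ x ∷ L → toℕ x < toℕ p → p ∈ L
    beyondHead (here refl) x<x = ⊥-elim (ℕP.<-irrefl refl x<x)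
    beyondHead (there p∈) _    = p∈

    headFirst : ∀ {x p : Fin m} {L} → Sorted (x ∷ L) → p ∈ x ∷ L → ¬ toℕ p < toℕ x
    headFirst _          (here refl) x<x = ℕP.<-irrefl refl x<x
    headFirst (x< ∷ _)   (there p∈)  p<x = ℕP.<-asym p<x (All.lookup x< p∈)

  firstKept-head : ∀ {x L} → Sorted (x ∷ L) → Kept x → FirstKept (x ∷ L) x L
  firstKept-head {x} {L} sorted@(x< ∷ sortedL) kx = record
    { member = here refl ; kept = kx
    ; before = λ p∈ p<x → ⊥-elim (headFirst sorted p∈ p<x)
    ; after = beyondHead ; within = λ p∈ → there p∈ , All.lookup x< p∈
    ; sorted = sortedL ; unfold = keep L kx }

  firstKept-skip : ∀ {x j L R} → ¬ Kept x → toℕ x < toℕ j →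
                   FirstKept L j R → FirstKept (x ∷ L) j R
  firstKept-skip {x} {j} {L} ¬kx x<j fk = record
    { member = there member ; kept = kept
    ; before = λ { (here refl) _ → ¬kx ; (there p∈) → before p∈ }
    ; after = λ { (here refl) j<x → ⊥-elim (ℕP.<-asym j<x x<j) ; (there p∈) → after p∈ }
    ; within = λ p∈ → there (proj₁ (within p∈)) , proj₂ (within p∈)
    ; sorted = sorted
    ; unfold = trans (skip L ¬kx) unfold }
    where open FirstKept fk

  firstKept-intro : ∀ {L j} → Sorted L → j ∈ L → Kept j →
                    (∀ {p} → p ∈ L → toℕ p < toℕ j → ¬ Kept p) →
                    ∃[ R ] FirstKept L j R
  firstKept-intro {_ ∷ L} sorted (here refl) kj _ = L , firstKept-head sorted kj
  firstKept-intro (x< ∷ sortedL) (there j∈) kj dropped =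
    let R , fk = firstKept-intro sortedL j∈ kj (λ p∈ → dropped (there p∈))
        x<j = All.lookup x< j∈
    in  R , firstKept-skip (dropped (here refl) x<j) x<j fk

  firstKept-elim : ∀ {L b ys} → Sorted L → restrict L ≡ b ∷ ys →
                   ∃[ j ] ∃[ R ] FirstKept L j R × f j ≡ b × restrict R ≡ ys
  firstKept-elim {L} {b} {ys} sorted eq =
    let j , R , fk = first sorted eq
    in  j , R , fk , ∷-injective (trans (sym (FirstKept.unfold fk)) eq)
    where
      first : ∀ {L} → Sorted L → restrict L ≡ b ∷ ys → ∃[ j ] ∃[ R ] FirstKept L j R
      first {x ∷ L} sorted@(x< ∷ sortedL) eq with toℕ (f x) ℕP.<? K
      ... | yes kx = x , L , firstKept-head sorted kx
      ... | no ¬kx =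
        let j , R , fk = first sortedL (trans (sym (skip L ¬kx)) eq)
        in  j , R , firstKept-skip ¬kx (All.lookup x< (FirstKept.member fk)) fk

  record Descent (L : List (Fin m)) : Set where
    field
      i j l  : Fin m
      i∈     : i ∈ L
      j∈     : j ∈ L
      l∈     : l ∈ L
      i<j    : toℕ i < toℕ j
      j<l    : toℕ j < toℕ l
      fj<fi  : toℕ (f j) < toℕ (f i)
      fl<fj  : toℕ (f l) < toℕ (f j)
      kept-i : Kept i
      kept-j : Kept j
      kept-l : Kept l
      gap    : ∀ {p} → p ∈ L → InGaps (toℕ i) (toℕ j) (toℕ l) (toℕ p) → ¬ Kept p

  transfer : ∀ {L L′} (d : Descent L) → let open Descent d in
             i ∈ L′ → j ∈ L′ → l ∈ L′ → (∀ {p} → p ∈ L′ → toℕ i < toℕ p → p ∈ L) →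
             Descent L′
  transfer d i∈′ j∈′ l∈′ fromL′ = record
    { i = i ; j = j ; l = l ; i∈ = i∈′ ; j∈ = j∈′ ; l∈ = l∈′
    ; i<j = i<j ; j<l = j<l ; fj<fi = fj<fi ; fl<fj = fl<fj
    ; kept-i = kept-i ; kept-j = kept-j ; kept-l = kept-l
    ; gap = λ p∈ between → gap (fromL′ p∈ (after-i between)) between }
    where
      open Descent d
      after-i : ∀ {p} → InGaps (toℕ i) (toℕ j) (toℕ l) p → toℕ i < p
      after-i (inj₁ (i<p , _)) = i<p
      after-i (inj₂ (j<p , _)) = ℕP.<-trans i<j j<p

  prepend : ∀ {x} L → HasDoubleDescent (restrict L) → HasDoubleDescent (restrict (x ∷ L))
  prepend {x} L dd with toℕ (f x) ℕP.<? K
  ... | yes kx = subst HasDoubleDescent (sym (keep L kx)) (there dd)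
  ... | no ¬kx = subst HasDoubleDescent (sym (skip L ¬kx)) dd

  descent⇒doubleDescent : ∀ {L} → Sorted L → Descent L → HasDoubleDescent (restrict L)
  descent⇒doubleDescent {x ∷ L} sorted@(x< ∷ sortedL) d with Descent.i∈ d
  ... | here i≡x = atHead i≡x
    where
      open Descent d
      atHead : i ≡ x → HasDoubleDescent (restrict (x ∷ L))
      atHead refl =
        let R₁ , fk₁ = firstKept-intro sortedL (beyondHead j∈ i<j) kept-j
                         (λ p∈ p<j → gap (there p∈) (inj₁ (All.lookup x< p∈ , p<j)))
            open FirstKept fk₁ using (after; within)
            R₂ , fk₂ = firstKept-intro (FirstKept.sorted fk₁)
                         (after (beyondHead l∈ (ℕP.<-trans i<j j<l)) j<l) kept-l
                         (λ p∈ p<l → gap (there (proj₁ (within p∈))) (inj₂ (proj₂ (within p∈) , p<l)))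
            front : restrict (x ∷ L) ≡ f i ∷ f j ∷ f l ∷ restrict R₂
            front = trans (keep L kept-i)
                      (cong (f i ∷_) (trans (FirstKept.unfold fk₁) (cong (f j ∷_) (FirstKept.unfold fk₂))))
        in  subst HasDoubleDescent (sym front) (here fj<fi fl<fj)
  ... | there i∈L = prepend L (descent⇒doubleDescent sortedL
          (transfer d i∈L (beyondHead j∈ (ℕP.<-trans x<i i<j))
                          (beyondHead l∈ (ℕP.<-trans x<i (ℕP.<-trans i<j j<l))) (λ p∈ _ → there p∈)))
    where
      open Descent d
      x<i = All.lookup x< i∈L

  doubleDescent⇒descent : ∀ {ws} → HasDoubleDescent ws →
                          ∀ {L} → Sorted L → restrict L ≡ ws → Descent L
  doubleDescent⇒descent (here b<a c<b) sorted eq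
    with firstKept-elim sorted eq
  ... | i , R₁ , fk₁ , refl , eq₁ with firstKept-elim (FirstKept.sorted fk₁) eq₁
  ... | j , R₂ , fk₂ , refl , eq₂ with firstKept-elim (FirstKept.sorted fk₂) eq₂
  ... | l , R₃ , fk₃ , refl , _ = record
    { i = i ; j = j ; l = l
    ; i∈ = FirstKept.member fk₁ ; j∈ = proj₁ j∈R₁ ; l∈ = proj₁ (within₁ (proj₁ l∈R₂))
    ; i<j = proj₂ j∈R₁ ; j<l = proj₂ l∈R₂ ; fj<fi = b<a ; fl<fj = c<b
    ; kept-i = FirstKept.kept fk₁ ; kept-j = FirstKept.kept fk₂ ; kept-l = FirstKept.kept fk₃
    ; gap = λ { p∈ (inj₁ (i<p , p<j)) → FirstKept.before fk₂ (after₁ p∈ i<p) p<j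
              ; p∈ (inj₂ (j<p , p<l)) → FirstKept.before fk₃
                   (FirstKept.after fk₂ (after₁ p∈ (ℕP.<-trans (proj₂ j∈R₁) j<p)) j<p) p<l } }
    where
      open FirstKept fk₁ using () renaming (within to within₁; after to after₁)
      j∈R₁ = within₁ (FirstKept.member fk₂)
      l∈R₂ = FirstKept.within fk₂ (FirstKept.member fk₃)
  doubleDescent⇒descent (there dd) sorted eq with firstKept-elim sorted eq
  ... | i₀ , R , fk , _ , eqR =
    let d = doubleDescent⇒descent dd (FirstKept.sorted fk) eqR
        open Descent d using (i∈; j∈; l∈)
        open FirstKept fk using (within; after)
    in  transfer d (proj₁ (within i∈)) (proj₁ (within j∈)) (proj₁ (within l∈))
                   (λ p∈ i<p → after p∈ (ℕP.<-trans (proj₂ (within i∈)) i<p))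

module PermutationDescent {n : ℕ} (π : Permutation′ n) (K : ℕ) where
  open Restriction (π ⟨$⟩ʳ_) K public using (Kept; Descent)

  descent⇒doubleDescent : Descent (allFin n) → HasDoubleDescent (restrictWord K π)
  descent⇒doubleDescent = Restriction.descent⇒doubleDescent _ K (allFin-sorted n)

  doubleDescent⇒descent : HasDoubleDescent (restrictWord K π) → Descent (allFin n)
  doubleDescent⇒descent dd = Restriction.doubleDescent⇒descent _ K dd (allFin-sorted n) refl

  doubleDescent : ∀ {i j l} → toℕ i < toℕ j → toℕ j < toℕ l →
                  toℕ (π ⟨$⟩ʳ j) < toℕ (π ⟨$⟩ʳ i) → toℕ (π ⟨$⟩ʳ l) < toℕ (π ⟨$⟩ʳ j) →
                  Kept i → Kept j → Kept l →
                  (∀ p → InGaps (toℕ i) (toℕ j) (toℕ l) (toℕ p) → ¬ Kept p) →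
                  HasDoubleDescent (restrictWord K π)
  doubleDescent {i} {j} {l} i<j j<l fj<fi fl<fj ki kj kl gap = descent⇒doubleDescent record
    { i = i ; j = j ; l = l ; i∈ = ∈-allFin i ; j∈ = ∈-allFin j ; l∈ = ∈-allFin l
    ; i<j = i<j ; j<l = j<l ; fj<fi = fj<fi ; fl<fj = fl<fj
    ; kept-i = ki ; kept-j = kj ; kept-l = kl ; gap = λ {p} _ → gap p }

below-suc : ∀ {Q : ℕ → Set} {h} → (∀ {u} → u < h → Q u) → Q h → ∀ {u} → u < suc h → Q u
below-suc {h = h} below qh {u} u<1+h with ℕP.m≤n⇒m<n∨m≡n (ℕP.≤-pred u<1+h)
... | inj₁ u<h  = below u<h
... | inj₂ refl = qh

module Extremal {P : ℕ → Set} (P? : Decidable P) where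

  leastBelow : ∀ h → (∀ {u} → u < h → ¬ P u) ⊎ (∃[ v ] v < h × P v × (∀ {u} → u < v → ¬ P u))
  leastBelow zero = inj₁ λ ()
  leastBelow (suc h) with leastBelow h
  ... | inj₂ (v , v<h , pv , below) = inj₂ (v , ℕP.m<n⇒m<1+n v<h , pv , below)
  ... | inj₁ none with P? h
  ...   | yes ph = inj₂ (h , ℕP.≤-refl , ph , none)
  ...   | no ¬ph = inj₁ (below-suc {Q = λ u → ¬ P u} none ¬ph)

  least : ∀ {w} → P w → ∃[ v ] v ≤ w × P v × (∀ {u} → u < v → ¬ P u)
  least {w} pw with leastBelow (suc w)
  ... | inj₁ none = contradiction pw (none ℕP.≤-refl)
  ... | inj₂ (v , v<1+w , pv , below) = v , ℕP.≤-pred v<1+w , pv , below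

  greatest : ∀ {w hi} → w < hi → P w →
             ∃[ v ] w ≤ v × v < hi × P v × (∀ {u} → v < u → u < hi → ¬ P u)
  greatest {w} {suc h} w<1+h pw with P? h
  ... | yes ph = h , ℕP.≤-pred w<1+h , ℕP.≤-refl , ph ,
                 λ h<u u<1+h _ → ℕP.<-irrefl refl (ℕP.<-≤-trans h<u (ℕP.≤-pred u<1+h))
  ... | no ¬ph with ℕP.m≤n⇒m<n∨m≡n (ℕP.≤-pred w<1+h)
  ...   | inj₂ refl = contradiction pw ¬ph
  ...   | inj₁ w<h with greatest w<h pw
  ...     | v , w≤v , v<h , pv , above =
    v , w≤v , ℕP.m<n⇒m<1+n v<h , pv ,
    λ v<u u<1+h → below-suc {Q = λ u → v < u → ¬ P u} (λ u<h v<u → above v<u u<h) (λ _ → ¬ph) u<1+h v<u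

module ExtremalFin {n : ℕ} {Q : Fin n → Set} (Q? : Decidable Q) where

  private
    OnIndex : ℕ → Set
    OnIndex u = ∃[ x ] toℕ x ≡ u × Q x

    onIndex? : Decidable OnIndex
    onIndex? u with u ℕP.<? n
    ... | no u≮n = no λ { (x , refl , _) → u≮n (FinP.toℕ<n x) }
    ... | yes u<n = map′ (λ q → fromℕ< u<n , FinP.toℕ-fromℕ< u<n , q)
                         (λ { (x , refl , q) → subst Q (sym (FinP.fromℕ<-toℕ x u<n)) q })
                         (Q? (fromℕ< u<n))

    open Extremal onIndex?

  record Least (w : Fin n) : Set where
    field
      element : Fin n
      ≤w      : toℕ element ≤ toℕ w
      holds   : Q element
      minimal : ∀ {u} → toℕ u < toℕ element → ¬ Q u

  record Greatest (w : Fin n) (hi : ℕ) : Set where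
    field
      element : Fin n
      w≤      : toℕ w ≤ toℕ element
      <hi     : toℕ element < hi
      holds   : Q element
      maximal : ∀ {u} → toℕ element < toℕ u → toℕ u < hi → ¬ Q u

  leastFin : ∀ {w} → Q w → Least w
  leastFin {w} qw with least (w , refl , qw)
  ... | _ , v≤w , (v , refl , qv) , below = record
    { element = v ; ≤w = v≤w ; holds = qv ; minimal = λ u<v qu → below u<v (_ , refl , qu) }

  greatestFin : ∀ {w hi} → toℕ w < hi → Q w → Greatest w hi
  greatestFin {w} w<hi qw with greatest w<hi (w , refl , qw)
  ... | _ , w≤v , v<hi , (v , refl , qv) , above = record
    { element = v ; w≤ = w≤v ; <hi = v<hi ; holds = qv
    ; maximal = λ v<u u<hi qu → above v<u u<hi (_ , refl , qu) }

-- A pattern ω ∈ 𝔖ₜ in one-line notation, described by its rank function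
-- (ω j = rank j + 1) and by the list of its indices in increasing order of value.
record Shape {t : ℕ} (ω : Vec ℕ t) : Set where
  field
    rank        : Vec (Fin t) t
    sorted      : Vec (Fin t) t
    value-rank  : ∀ j → lookup ω j ≡ suc (toℕ (lookup rank j))
    sorted-rank : ∀ j → lookup sorted (lookup rank j) ≡ j

  injective : ∀ {j k} → lookup ω j ≡ lookup ω k → j ≡ k
  injective {j} {k} ωj≡ωk =
    trans (sym (sorted-rank j))
      (trans (cong (lookup sorted)
                (FinP.toℕ-injective (ℕP.suc-injective (trans (sym (value-rank j)) (trans ωj≡ωk (value-rank k))))))
             (sorted-rank k))

-- The two defining identities of a shape are finite, so for a concrete
-- pattern they are checked by evaluation.
mkShape : ∀ {t} (ω : Vec ℕ t) (rank sorted : Vec (Fin t) t) →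
          {_ : True (all? λ j → lookup ω j ℕP.≟ suc (toℕ (lookup rank j)))} →
          {_ : True (all? λ j → lookup sorted (lookup rank j) FinP.≟ j)} → Shape ω
mkShape ω rank sorted {ok₁} {ok₂} = record
  { rank = rank ; sorted = sorted ; value-rank = toWitness ok₁ ; sorted-rank = toWitness ok₂ }

shape213 : Shape p213
shape213 = mkShape p213 (# 1 ∷ # 0 ∷ # 2 ∷ []) (# 1 ∷ # 0 ∷ # 2 ∷ [])

shape4132 : Shape p4132
shape4132 = mkShape p4132 (# 3 ∷ # 0 ∷ # 2 ∷ # 1 ∷ []) (# 1 ∷ # 3 ∷ # 2 ∷ # 0 ∷ [])

shape51342 : Shape p51342
shape51342 = mkShape p51342 (# 4 ∷ # 0 ∷ # 2 ∷ # 3 ∷ # 1 ∷ []) (# 1 ∷ # 4 ∷ # 2 ∷ # 3 ∷ # 0 ∷ [])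

Increasing : Vec (Fin 5) 4 → Set
Increasing e = ∀ j k → toℕ j < toℕ k → toℕ (lookup e j) < toℕ (lookup e k)

PreservesOrder : Vec (Fin 5) 4 → Set
PreservesOrder e = ∀ j k → lookup p4132 j < lookup p4132 k →
                   lookup p51342 (lookup e j) < lookup p51342 (lookup e k)

-- 51342 without its entry 3, resp. its entry 4, is a copy of 4132.
without3 without4 : Vec (Fin 5) 4
without3 = # 0 ∷ # 1 ∷ # 3 ∷ # 4 ∷ []
without4 = # 0 ∷ # 1 ∷ # 2 ∷ # 4 ∷ []

-- These are the only increasing, order-preserving index maps.  The check is
-- by evaluation over all of Fin 5 ⁴, kept abstract so it is never unfolded.
abstract
  embeddings4132in51342 : ∀ a b c d → let e = a ∷ b ∷ c ∷ d ∷ [] in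
                          Increasing e → PreservesOrder e → e ≡ without3 ⊎ e ≡ without4
  embeddings4132in51342 = from-yes
    (all? λ a → all? λ b → all? λ c → all? λ d → let e = a ∷ b ∷ c ∷ d ∷ [] in
       increasing? e →-dec preserves? e →-dec (≡-dec FinP._≟_ e without3 ⊎-dec ≡-dec FinP._≟_ e without4))
    where
      increasing? : ∀ e → Dec (Increasing e)
      increasing? e = all? λ j → all? λ k → (toℕ j ℕP.<? toℕ k) →-dec (toℕ (lookup e j) ℕP.<? toℕ (lookup e k))
      preserves? : ∀ e → Dec (PreservesOrder e)
      preserves? e = all? λ j → all? λ k → (lookup p4132 j ℕP.<? lookup p4132 k) →-dec
                     (lookup p51342 (lookup e j) ℕP.<? lookup p51342 (lookup e k))

decided : ∀ {m n} {ok : True (m ℕP.<? n)} → m < n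
decided {ok = ok} = toWitness ok

module Permutation {n : ℕ} (σ : Permutation′ n) where

  value : Fin n → ℕ
  value p = toℕ (σ ⟨$⟩ʳ p)

  place : Fin n → ℕ
  place v = toℕ (σ ⟨$⟩ˡ v)

  place-value : ∀ p → place (σ ⟨$⟩ʳ p) ≡ toℕ p
  place-value p = cong toℕ (inverseˡ σ)

  value-place : ∀ v → value (σ ⟨$⟩ˡ v) ≡ toℕ v
  value-place v = cong toℕ (inverseʳ σ)

  value-at : ∀ {v p} → place v ≡ toℕ p → value p ≡ toℕ v
  value-at {v} v-at-p = trans (cong value (sym (FinP.toℕ-injective v-at-p))) (value-place v)

  place-at : ∀ {v p} → toℕ v ≡ value p → place v ≡ toℕ p
  place-at {v} {p} v≡vp = trans (cong place (FinP.toℕ-injective v≡vp)) (place-value p)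

  value-injective : ∀ {p q} → value p ≡ value q → p ≡ q
  value-injective {p} {q} vp≡vq =
    trans (sym (inverseˡ σ))
      (trans (cong (σ ⟨$⟩ˡ_) (FinP.toℕ-injective vp≡vq)) (inverseˡ σ))

  occurrence : ∀ {t} {ω : Vec ℕ t} (S : Shape ω) (P : Vec (Fin n) t) →
               Linked (λ p q → toℕ p < toℕ q) P →
               Linked (λ p q → value p < value q) (Vec.map (lookup P) (Shape.sorted S)) →
               Occurrence ω σ
  occurrence {ω = ω} S P positions values = record
    { pos = lookup P
    ; increasing = λ j k j<k → lookup⁺ ℕP.<-trans positions j<k
    ; orderIso = λ j k → mk⇔ (reflect j k) (preserve j k) }
    where
      open Shape S
      atRank : ∀ j → lookup (Vec.map (lookup P) sorted) (lookup rank j) ≡ lookup P j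
      atRank j = trans (lookup-map (lookup rank j) (lookup P) sorted) (cong (lookup P) (sorted-rank j))

      preserve : ∀ j k → lookup ω j < lookup ω k → value (lookup P j) < value (lookup P k)
      preserve j k ωj<ωk =
        subst₂ (λ p q → value p < value q) (atRank j) (atRank k)
          (lookup⁺ ℕP.<-trans values (ℕP.≤-pred (subst₂ _<_ (value-rank j) (value-rank k) ωj<ωk)))

      reflect : ∀ j k → value (lookup P j) < value (lookup P k) → lookup ω j < lookup ω k
      reflect j k v< with ℕP.<-cmp (lookup ω j) (lookup ω k)
      ... | tri< ωj<ωk _ _ = ωj<ωk
      ... | tri≈ _ ωj≡ωk _ = contradiction
        (subst (λ i → value (lookup P j) < value (lookup P i)) (sym (injective ωj≡ωk)) v<) (ℕP.<-irrefl refl)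
      ... | tri> _ _ ωk<ωj = contradiction (preserve k j ωk<ωj) (ℕP.<-asym v<)

  module _ {t} {ω : Vec ℕ t} (O : Occurrence ω σ) where

    ordered : ∀ j k → lookup ω j < lookup ω k → value (pos O j) < value (pos O k)
    ordered j k = Equivalence.from (orderIso O j k)

    index-order : ∀ {j k} → toℕ (pos O j) < toℕ (pos O k) → toℕ j < toℕ k
    index-order {j} {k} pj<pk with ℕP.<-cmp (toℕ j) (toℕ k)
    ... | tri< j<k _ _ = j<k
    ... | tri≈ _ j≡k _ = contradiction
      (subst (λ i → toℕ (pos O i) < toℕ (pos O k)) (FinP.toℕ-injective j≡k) pj<pk) (ℕP.<-irrefl refl)
    ... | tri> _ _ k<j = contradiction (increasing O k j k<j) (ℕP.<-asym pj<pk)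

  module Extension (o : Occurrence p4132 σ) where

    a b c d : Fin n
    a = pos o (# 0)
    b = pos o (# 1)
    c = pos o (# 2)
    d = pos o (# 3)

    a<b : toℕ a < toℕ b
    a<b = increasing o (# 0) (# 1) decided
    b<c : toℕ b < toℕ c
    b<c = increasing o (# 1) (# 2) decided
    c<d : toℕ c < toℕ d
    c<d = increasing o (# 2) (# 3) decided

    vb<vd : value b < value d
    vb<vd = ordered o (# 1) (# 3) decided
    vd<vc : value d < value c
    vd<vc = ordered o (# 3) (# 2) decided
    vc<va : value c < value a
    vc<va = ordered o (# 2) (# 0) decided

    -- A filler of o is a letter which, inserted into o, forms a 51342: either
    -- a "3" between the 1 and the 3 of o, or a "4" between its 3 and its 2.
    data Filler : Set where
      insert3 : ∀ q → toℕ b < toℕ q → toℕ q < toℕ c → value d < value q → value q < value c → Filler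
      insert4 : ∀ q → toℕ c < toℕ q → toℕ q < toℕ d → value c < value q → value q < value a → Filler

    filler⇒contained : Filler → ContainedIn51342 o
    filler⇒contained (insert3 q b<q q<c vd<vq vq<vc) =
      occurrence shape51342 (a ∷ b ∷ q ∷ c ∷ d ∷ [])
        (a<b ∷ b<q ∷ q<c ∷ c<d ∷ [-]) (vb<vd ∷ vd<vq ∷ vq<vc ∷ vc<va ∷ [-]) ,
      λ { zero → # 0 , refl ; (suc zero) → # 1 , refl
        ; (suc (suc zero)) → # 3 , refl ; (suc (suc (suc zero))) → # 4 , refl }
    filler⇒contained (insert4 q c<q q<d vc<vq vq<va) =
      occurrence shape51342 (a ∷ b ∷ c ∷ q ∷ d ∷ [])
        (a<b ∷ b<c ∷ c<q ∷ q<d ∷ [-]) (vb<vd ∷ vd<vc ∷ vc<vq ∷ vq<va ∷ [-]) ,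
      λ { zero → # 0 , refl ; (suc zero) → # 1 , refl
        ; (suc (suc zero)) → # 2 , refl ; (suc (suc (suc zero))) → # 4 , refl }

    -- Conversely, in an occurrence O of 51342 containing o, the letter of O
    -- outside o is a filler: the index map from o to O is increasing and order
    -- preserving, hence deletes the entry 3 or the entry 4 of 51342.
    module _ (O : Occurrence p51342 σ) (contains : ∀ j → ∃ λ k → pos o j ≡ pos O k) where

      private
        e : Fin 4 → Fin 5
        e j = proj₁ (contains j)

        at : ∀ j → pos o j ≡ pos O (e j)
        at j = proj₂ (contains j)

        e-increasing : Increasing (tabulate e)
        e-increasing j k j<k =
          subst₂ (λ x y → toℕ x < toℕ y) (sym (lookup∘tabulate e j)) (sym (lookup∘tabulate e k))
            (index-order O (subst₂ (λ x y → toℕ x < toℕ y) (at j) (at k) (increasing o j k j<k)))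

        e-preserves : PreservesOrder (tabulate e)
        e-preserves j k ωj<ωk =
          subst₂ (λ x y → lookup p51342 x < lookup p51342 y) (sym (lookup∘tabulate e j)) (sym (lookup∘tabulate e k))
            (Equivalence.to (orderIso O (e j) (e k))
              (subst₂ (λ x y → value x < value y) (at j) (at k) (ordered o j k ωj<ωk)))

        at′ : ∀ {E} → tabulate e ≡ E → ∀ j → pos o j ≡ pos O (lookup E j)
        at′ e≡E j = trans (at j) (cong (pos O) (trans (sym (lookup∘tabulate e j)) (cong (λ v → lookup v j) e≡E)))

        insert3′ : ∀ {b′ c′ d′} → b ≡ b′ → c ≡ c′ → d ≡ d′ → ∀ q →
                   toℕ b′ < toℕ q → toℕ q < toℕ c′ → value d′ < value q → value q < value c′ → Filler
        insert3′ refl refl refl = insert3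
        insert4′ : ∀ {a′ c′ d′} → a ≡ a′ → c ≡ c′ → d ≡ d′ → ∀ q →
                   toℕ c′ < toℕ q → toℕ q < toℕ d′ → value c′ < value q → value q < value a′ → Filler
        insert4′ refl refl refl = insert4

      fillerIn : Filler
      fillerIn with embeddings4132in51342 (e (# 0)) (e (# 1)) (e (# 2)) (e (# 3)) e-increasing e-preserves
      ... | inj₁ e≡ = insert3′ (at′ e≡ (# 1)) (at′ e≡ (# 2)) (at′ e≡ (# 3)) (pos O (# 2))
        (increasing O (# 1) (# 2) decided) (increasing O (# 2) (# 3) decided)
        (ordered O (# 4) (# 2) decided) (ordered O (# 2) (# 3) decided)
      ... | inj₂ e≡ = insert4′ (at′ e≡ (# 0)) (at′ e≡ (# 2)) (at′ e≡ (# 3)) (pos O (# 3))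
        (increasing O (# 2) (# 3) decided) (increasing O (# 3) (# 4) decided)
        (ordered O (# 2) (# 3) decided) (ordered O (# 3) (# 0) decided)

    contained⇒filler : ContainedIn51342 o → Filler
    contained⇒filler (O , contains) = fillerIn O contains

  -- Let σ be simsun and suppose σ⁻¹ has a double
  -- descent on its letters below k, i.e. letters x < y < z sitting in σ at
  -- positions L > J > I, with every letter strictly between x and y, or
  -- between y and z, placed at k or later.  Take the first position p > I,
  -- p ≠ J, with value p ≤ z.  Then value p ≤ x; if p > J then I, J, p is a
  -- double descent of σ on the letters ≤ z, and if p < J then I p J L is a
  -- 4132 without a filler.
  module Backward (simsun : Simsun σ) (k : ℕ)
                  (descent : PermutationDescent.Descent (flip σ) k (allFin n)) where

    open Restriction.Descent descent renaming (i to x; j to y; l to z)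
    open Extension using (insert3; insert4)

    I J L : Fin n
    I = σ ⟨$⟩ˡ z
    J = σ ⟨$⟩ˡ y
    L = σ ⟨$⟩ˡ x

    I<J : toℕ I < toℕ J
    I<J = fl<fj
    J<L : toℕ J < toℕ L
    J<L = fj<fi
    L<k : toℕ L < k
    L<k = kept-i

    vI≡z : value I ≡ toℕ z
    vI≡z = value-place z
    vJ≡y : value J ≡ toℕ y
    vJ≡y = value-place y
    vL≡x : value L ≡ toℕ x
    vL≡x = value-place x

    outsideGaps : ∀ q → toℕ q < k → ¬ InGaps (toℕ x) (toℕ y) (toℕ z) (value q)
    outsideGaps q q<k between = gap (∈-allFin (σ ⟨$⟩ʳ q)) between (subst (_< k) (sym (place-value q)) q<k)

    Candidate : Fin n → Set
    Candidate p = toℕ I < toℕ p × value p ≤ toℕ z × p ≢ J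

    candidate? : Decidable Candidate
    candidate? p = (toℕ I ℕP.<? toℕ p) ×-dec (value p ℕP.≤? toℕ z) ×-dec ¬? (p FinP.≟ J)

    L-candidate : Candidate L
    L-candidate = ℕP.<-trans I<J J<L , ℕP.≤-trans (ℕP.≤-reflexive vL≡x) (ℕP.<⇒≤ (ℕP.<-trans i<j j<l)) ,
                  λ L≡J → ℕP.<-irrefl (cong toℕ (sym L≡J)) J<L

    open ExtremalFin.Least (ExtremalFin.leastFin candidate? L-candidate)
      renaming (element to p; ≤w to p≤L; holds to p-candidate; minimal to earlier)

    I<p : toℕ I < toℕ p
    I<p = proj₁ p-candidate
    vp≤z : value p ≤ toℕ z
    vp≤z = proj₁ (proj₂ p-candidate)
    p≢J : p ≢ J
    p≢J = proj₂ (proj₂ p-candidate)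

    p<k : toℕ p < k
    p<k = ℕP.≤-<-trans p≤L L<k

    -- value p ≤ x: a larger letter would be y, z, or lie in one of the gaps.
    vp≤x : value p ≤ toℕ x
    vp≤x with ℕP.≤-<-connex (value p) (toℕ x)
    ... | inj₁ vp≤x = vp≤x
    ... | inj₂ x<vp = ⊥-elim (outsideGaps p p<k inGaps)
      where
        vp≢z : value p ≢ toℕ z
        vp≢z vp≡z = ℕP.<-irrefl (cong toℕ (value-injective (trans vI≡z (sym vp≡z)))) I<p
        inGaps : InGaps (toℕ x) (toℕ y) (toℕ z) (value p)
        inGaps with ℕP.<-cmp (value p) (toℕ y)
        ... | tri< vp<y _ _ = inj₁ (x<vp , vp<y)
        ... | tri≈ _ vp≡y _ = ⊥-elim (p≢J (value-injective (trans vp≡y (sym vJ≡y))))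
        ... | tri> _ _ y<vp = inj₂ (y<vp , ℕP.≤∧≢⇒< vp≤z vp≢z)

    -- If J < p, then I, J, p is a double descent of σ on the letters ≤ z.
    p≯J : ¬ toℕ J < toℕ p
    p≯J J<p = simsun (suc (toℕ z)) (FinP.toℕ<n z)
      (PermutationDescent.doubleDescent σ (suc (toℕ z)) I<J J<p
        (subst₂ _<_ (sym vJ≡y) (sym vI≡z) j<l)
        (subst (value p <_) (sym vJ≡y) (ℕP.≤-<-trans vp≤x i<j))
        (s≤s (ℕP.≤-reflexive vI≡z)) (s≤s (subst (_≤ toℕ z) (sym vJ≡y) (ℕP.<⇒≤ j<l))) (s≤s vp≤z)
        dropped)
      where
        dropped : ∀ u → InGaps (toℕ I) (toℕ J) (toℕ p) (toℕ u) → ¬ value u < suc (toℕ z)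
        dropped u (inj₁ (I<u , u<J)) (s≤s vu≤z) =
          earlier (ℕP.<-trans u<J J<p) (I<u , vu≤z , λ u≡J → ℕP.<-irrefl (cong toℕ u≡J) u<J)
        dropped u (inj₂ (J<u , u<p)) (s≤s vu≤z) =
          earlier u<p (ℕP.<-trans I<J J<u , vu≤z , λ u≡J → ℕP.<-irrefl (cong toℕ (sym u≡J)) J<u)

    -- If p < J, then I p J L is an occurrence of 4132 ...
    occurrence4132 : toℕ p < toℕ J → Occurrence p4132 σ
    occurrence4132 p<J = occurrence shape4132 (I ∷ p ∷ J ∷ L ∷ [])
      (I<p ∷ p<J ∷ J<L ∷ [-])
      (ℕP.≤∧≢⇒< (subst (value p ≤_) (sym vL≡x) vp≤x)
                (λ vp≡vL → ℕP.<-irrefl (cong toℕ (value-injective vp≡vL)) (ℕP.<-trans p<J J<L)) ∷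
       subst₂ _<_ (sym vL≡x) (sym vJ≡y) i<j ∷ subst₂ _<_ (sym vJ≡y) (sym vI≡z) j<l ∷ [-])

    -- ... without a filler: a filler would be a letter in the gaps placed before L.
    noFiller : (p<J : toℕ p < toℕ J) → ¬ Extension.Filler (occurrence4132 p<J)
    noFiller _ (insert3 q _ q<J vL<vq vq<vJ) =
      outsideGaps q (ℕP.<-trans (ℕP.<-trans q<J J<L) L<k)
        (inj₁ (subst (_< value q) vL≡x vL<vq , subst (value q <_) vJ≡y vq<vJ))
    noFiller _ (insert4 q _ q<L vJ<vq vq<vI) =
      outsideGaps q (ℕP.<-trans q<L L<k)
        (inj₂ (subst (_< value q) vJ≡y vJ<vq , subst (value q <_) vI≡z vq<vI))

    impossible : ((o : Occurrence p4132 σ) → Extension.Filler o) → ⊥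
    impossible fill with ℕP.<-cmp (toℕ p) (toℕ J)
    ... | tri< p<J _ _ = noFiller p<J (fill (occurrence4132 p<J))
    ... | tri≈ _ p≡J _ = p≢J (FinP.toℕ-injective p≡J)
    ... | tri> _ _ J<p = p≯J J<p

  backward : Simsun σ → ((o : Occurrence p4132 σ) → Extension.Filler o) → Simsun (flip σ)
  backward simsun fill k _ dd =
    Backward.impossible simsun k (PermutationDescent.doubleDescent⇒descent (flip σ) k dd) fill

  -- Let σ avoid 213 with σ⁻¹ simsun, and let o be a
  -- 4132 at positions a < b < c < d.  Among the letters placed at or before d
  -- take m, the greatest one in [value d, value c), and M, the least one above
  -- value c.  If M sits after c it is a filler "4"; otherwise m cannot sit
  -- after c (m, value c, M would be a double descent of σ⁻¹ on the positions
  -- ≤ d), so m sits before c, after b (else m, b, c is a 213) and is a filler "3".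
  module Forward (avoids : Avoids p213 σ) (simsun⁻¹ : Simsun (flip σ))
                 (o : Occurrence p4132 σ) where

    open Extension o

    Early : Fin n → Set
    Early v = place v ≤ toℕ d

    early? : Decidable Early
    early? v = place v ℕP.≤? toℕ d

    open ExtremalFin.Greatest
      (ExtremalFin.greatestFin early? vd<vc (ℕP.≤-reflexive (place-value d)))
      renaming (element to m; w≤ to vd≤m; <hi to m<vc; holds to m-early; maximal to above-m)

    EarlyAbove-c : Fin n → Set
    EarlyAbove-c v = value c < toℕ v × Early v

    earlyAbove-c? : Decidable EarlyAbove-c
    earlyAbove-c? v = (value c ℕP.<? toℕ v) ×-dec early? v

    open ExtremalFin.Least
      (ExtremalFin.leastFin earlyAbove-c?
        (vc<va , ℕP.≤-trans (ℕP.≤-reflexive (place-value a)) (ℕP.<⇒≤ (ℕP.<-trans a<b (ℕP.<-trans b<c c<d)))))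
      renaming (element to M; ≤w to M≤va; holds to M-earlyAbove; minimal to below-M)

    vc<M : value c < toℕ M
    vc<M = proj₁ M-earlyAbove

    pm pM : Fin n
    pm = σ ⟨$⟩ˡ m
    pM = σ ⟨$⟩ˡ M

    fillerAbove : toℕ c < toℕ pM → Filler
    fillerAbove c<pM = insert4 pM c<pM pM<d
      (subst (value c <_) (sym (value-place M)) vc<M)
      (subst (_< value a) (sym (value-place M)) (ℕP.≤∧≢⇒< M≤va M≢va))
      where
        pM<d : toℕ pM < toℕ d
        pM<d = ℕP.≤∧≢⇒< (proj₂ M-earlyAbove)
                 λ pM≡d → ℕP.<-irrefl (value-at pM≡d) (ℕP.<-trans vd<vc vc<M)
        M≢va : toℕ M ≢ value a
        M≢va M≡va = ℕP.<-irrefl (sym (place-at M≡va)) (ℕP.<-trans a<b (ℕP.<-trans b<c c<pM))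

    -- If M sits before c and m after c, then m, value c, M is a double
    -- descent of σ⁻¹ on the positions ≤ d.
    notBothAcross : toℕ pM < toℕ c → toℕ c < toℕ pm → ⊥
    notBothAcross pM<c c<pm = simsun⁻¹ (suc (toℕ d)) (FinP.toℕ<n d)
      (PermutationDescent.doubleDescent (flip σ) (suc (toℕ d)) {m} {σ ⟨$⟩ʳ c} {M}
        m<vc vc<M
        (subst (_< toℕ pm) (sym (place-value c)) c<pm)
        (subst (toℕ pM <_) (sym (place-value c)) pM<c)
        (s≤s m-early) (s≤s (ℕP.≤-trans (ℕP.≤-reflexive (place-value c)) (ℕP.<⇒≤ c<d))) (s≤s (proj₂ M-earlyAbove))
        late)
      where
        late : ∀ v → InGaps (toℕ m) (value c) (toℕ M) (toℕ v) → ¬ place v < suc (toℕ d)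
        late v (inj₁ (m<v , v<vc)) (s≤s early) = above-m m<v v<vc early
        late v (inj₂ (vc<v , v<M)) (s≤s early) = below-M v<M (vc<v , early)

    vb<m : value b < toℕ m
    vb<m = ℕP.<-≤-trans vb<vd vd≤m

    vb<vpm : value b < value pm
    vb<vpm = subst (value b <_) (sym (value-place m)) vb<m

    vpm<vc : value pm < value c
    vpm<vc = subst (_< value c) (sym (value-place m)) m<vc

    -- m placed before c is a filler 3, since σ avoids 213.
    fillerBelow : toℕ pm < toℕ c → Filler
    fillerBelow pm<c with ℕP.<-cmp (toℕ pm) (toℕ b)
    ... | tri< pm<b _ _ = ⊥-elim (avoids (occurrence shape213 (pm ∷ b ∷ c ∷ [])
                            (pm<b ∷ b<c ∷ [-]) (vb<vpm ∷ vpm<vc ∷ [-])))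
    ... | tri≈ _ pm≡b _ = ⊥-elim (ℕP.<-irrefl (value-at pm≡b) vb<m)
    ... | tri> _ _ b<pm = insert3 pm b<pm pm<c vd<vpm vpm<vc
      where
        vd<vpm : value d < value pm
        vd<vpm = subst (value d <_) (sym (value-place m))
                   (ℕP.≤∧≢⇒< vd≤m λ vd≡m → ℕP.<-irrefl (place-at (sym vd≡m)) (ℕP.<-trans pm<c c<d))

    filler : Filler
    filler with ℕP.<-cmp (toℕ pM) (toℕ c) | ℕP.<-cmp (toℕ pm) (toℕ c)
    ... | tri> _ _ c<pM | _              = fillerAbove c<pM
    ... | tri≈ _ pM≡c _ | _              = ⊥-elim (ℕP.<-irrefl (value-at pM≡c) vc<M)
    ... | tri< _ _ _    | tri≈ _ pm≡c _  = ⊥-elim (ℕP.<-irrefl (sym (value-at pm≡c)) m<vc)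
    ... | tri< pM<c _ _ | tri> _ _ c<pm  = ⊥-elim (notBothAcross pM<c c<pm)
    ... | tri< _ _ _    | tri< pm<c _ _  = fillerBelow pm<c

theorem3p5 : (n : ℕ) (σ : Permutation′ n) →
    Simsun σ → Avoids p213 σ →
    (Simsun (flip σ) ⇔
      (Avoids p4132 σ ⊎ ((o : Occurrence p4132 σ) → ContainedIn51342 o)))
theorem3p5 n σ simsun avoids213 = mk⇔
  (λ simsun⁻¹ → inj₂ λ o → filler⇒contained o (Forward.filler avoids213 simsun⁻¹ o))
  (λ extensions → backward simsun (everyFiller extensions))
  where
    open Permutation σ
    open Extension using (Filler; filler⇒contained; contained⇒filler)

    everyFiller : Avoids p4132 σ ⊎ ((o : Occurrence p4132 σ) → ContainedIn51342 o) →
                  (o : Occurrence p4132 σ) → Filler o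
    everyFiller (inj₁ avoids4132) o = ⊥-elim (avoids4132 o)
    everyFiller (inj₂ contained)  o = contained⇒filler o (contained o)
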